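{- Let $T$ be a finite tree and $\Delta_T$ its Coxeter-like complex. The faces of $\Delta_T$ with distributable capacity form a subcomplex of $\Delta_T$. Moreover, if $(T',\mathbf{m}')$ is a tree with vertex capacities which has distributable capacity, and $C$ is the vertex obtained by merging (contracting the edge between) two neighboring vertices $C_1,C_2$ of $T'$, with $\mathrm{cap}(C)=\mathrm{cap}(C_1)+\mathrm{cap}(C_2)$, then $\mathrm{cap}(C)\ge \deg(C)$, where $\deg(C)$ is the degree of $C$ in the contracted tree.
   Context: A tree with capacities $(T,\mathbf{m})$ is a finite tree $T$ with a nonnegative integer $\mathrm{cap}(v)$ for each vertex $v$; set $N=\sum_v \mathrm{cap}(v)$. The complex $\Delta_{(T,\mathbf{m})}$ is the simplicial complex whose faces $F$ are pairs consisting of a set $E^C(F)\subseteq E(T)$ of deleted edges together with an assignment to each connected component $C$ of $T\setminus E^C(F)$ of a set of exactly $\sum_{v\in C}\mathrm{cap}(v)$ labels from $\{1,\dots,N\}$, these label sets partitioning $\{1,\dots,N\}$; $\dim F=|E^C(F)|-1$, and $\sigma\subseteq\tau$ iff $\sigma$ is obtained from $\tau$ by merging neighboring components (i.e. $E^C(\sigma)\subseteq E^C(\tau)$ and each component of $\sigma$ carries the union of the labels of the components of $\tau$ it contains). $\Delta_T$ denotes the case where all capacities equal $1$. Given $(T,\mathbf{m})$ and $E\subseteq E(T)$, the associated tree $(T',\mathbf{m}')$ has as vertices the components of $T\setminus E$, as edges the edges in $E$, and capacity of a component equal to the sum of capacities of its vertices. A tree with capacities has distributable capacity if every vertex $v$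 satisfies $\mathrm{cap}(v)\ge\deg(v)-1$. A face $F$ of $\Delta_T$ has distributable capacity if the tree associated to $(T,E^C(F))$ has distributable capacity. -}

module Defs where

open import Data.Nat using (ℕ; suc; _+_; _∸_; _≤_)
open import Data.Fin using (Fin; _≟_)
open import Data.Fin.Subset using (Subset; _∉_; _∈_; _⊆_; ⊥)
open import Data.List using (length; filter; allFin)
open import Data.Product using (Σ; _×_)
open import Data.Sum using (_⊎_)
open import Relation.Nullary using (¬_; ¬?)
open import Relation.Nullary.Decidable using (_×-dec_; _⊎-dec_)
open import Relation.Binary.PropositionalEquality using (_≡_)
open import Function.Bundles using (_↔_)

record Graph : Set where
  field
    n   : ℕ
    m   : ℕ
    src : Fin m → Fin n
    tgt : Fin m → Fin n
open Graph public

data Path (G : Graph) (S : Subset (m G)) : Fin (n G) → Fin (n G) → Set where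
  here : ∀ {v} → Path G S v v
  fwd  : ∀ {w} (e : Fin (m G)) → e ∉ S → Path G S (tgt G e) w → Path G S (src G e) w
  bwd  : ∀ {w} (e : Fin (m G)) → e ∉ S → Path G S (src G e) w → Path G S (tgt G e) w

record Conn (G : Graph) (S : Subset (m G)) (v w : Fin (n G)) : Set where
  constructor conn
  field
    .path : Path G S v w

record Tree : Set where
  field
    graph     : Graph
    edgeCount : suc (m graph) ≡ n graph
    connected : ∀ v w → Path graph ⊥ v w
open Tree public

HasSize : Set → ℕ → Set
HasSize A k = A ↔ Fin k

-- Faces of Δ_T (all capacities 1, so N = number of vertices).
-- A face is a set S of deleted edges together with a label assignment:
-- label i is put in the component of T ∖ S containing the vertex lab i
-- (only the component matters).  Validity: each component C receives
-- exactly |C| = Σ_{v∈C} cap(v) labels.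

record Face (T : Tree) : Set where
  field
    deleted : Subset (m (graph T))
    lab     : Fin (n (graph T)) → Fin (n (graph T))
    valid   : ∀ v → (Σ (Fin (n (graph T))) λ i → Conn (graph T) deleted (lab i) v)
                  ↔ (Σ (Fin (n (graph T))) λ w → Conn (graph T) deleted w v)
open Face public

-- σ ⊆ τ : σ arises from τ by merging neighbouring components:
-- E^C(σ) ⊆ E^C(τ), and every label lies, in σ, in the component of σ
-- containing its component in τ.
_≼_ : {T : Tree} → Face T → Face T → Set
_≼_ {T} σ τ = (deleted σ ⊆ deleted τ)
            × (∀ i → Conn (graph T) (deleted σ) (lab σ i) (lab τ i))

-- Tree associated to (T, S) (all capacities 1): vertices are the
-- components of T ∖ S, capacity = number of vertices of the component,
-- edges = S.  Degree of the component of v = number of edge-ends of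
-- edges in S lying in that component.
AssocDistributable : (T : Tree) → Subset (m (graph T)) → Set
AssocDistributable T S =
  ∀ v (c d : ℕ)
  → HasSize (Σ (Fin (n G)) λ w → Conn G S v w) c
  → HasSize (Σ (Fin (m G)) λ e → (e ∈ S) × (Conn G S v (src G e) ⊎ Conn G S v (tgt G e))) d
  → d ∸ 1 ≤ c
  where G = graph T

FaceDistributable : {T : Tree} → Face T → Set
FaceDistributable {T} F = AssocDistributable T (deleted F)

-- deg(v): number of edge-ends at v (a loop would count twice).
deg : (G : Graph) → Fin (n G) → ℕ
deg G v = length (filter (λ e → src G e ≟ v) (allFin (m G)))
        + length (filter (λ e → tgt G e ≟ v) (allFin (m G)))

Distributable : (T : Tree) → (Fin (n (graph T)) → ℕ) → Set
Distributable T cap = ∀ v → deg (graph T) v ∸ 1 ≤ cap v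

-- Degree of the vertex C obtained by contracting edge e (merging
-- C₁ = src e and C₂ = tgt e): edge-ends of edges e' ≠ e lying in {C₁, C₂}.
contractedDeg : (G : Graph) → Fin (m G) → ℕ
contractedDeg G e =
    length (filter (λ e′ → ¬? (e′ ≟ e) ×-dec (src G e′ ≟ src G e ⊎-dec src G e′ ≟ tgt G e)) (allFin (m G)))
  + length (filter (λ e′ → ¬? (e′ ≟ e) ×-dec (tgt G e′ ≟ src G e ⊎-dec tgt G e′ ≟ tgt G e)) (allFin (m G)))

-- Restoring one deleted edge f = ab merges the components K_a and K_b of T ∖ S (or leaves them
-- alone when a and b were already joined).  Every other component keeps its vertices and its ends of
-- deleted edges.  The merged component has at least c_a + c_b vertices and has lost the two ends of f,
-- so d - 1 ≤ (d_a - 1) + (d_b - 1) ≤ c_a + c_b: distributability survives, and restoring the edges of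
-- E^C(τ) ∖ E^C(σ) one at a time gives the first claim.  For the second, every edge-end counted in the
-- degree of the contracted vertex is counted in deg C₁ + deg C₂, which also counts both ends of the
-- contracted edge itself, and deg Cᵢ ≤ cap Cᵢ + 1.

module Submission where

open import Defs
open import Data.Bool using (Bool; true; false)
open import Data.Empty using (⊥-elim-irr)
open import Data.Fin using (Fin; zero; suc; toℕ; fromℕ<; _≟_)
open import Data.Fin.Properties using (+↔⊎; injective⇒≤; 1↔⊤; toℕ-injective; toℕ-fromℕ<)
open import Data.Fin.Subset using (Subset; _∈_; _∉_; _⊆_; ⊤)
open import Data.Fin.Subset.Properties using (_∈?_; ∈⊤; ⊆⊤; ⊆-antisym; drop-∷-⊆)
open import Data.List using ([]; _∷_; length; filter; allFin)
open import Data.List.Membership.Propositional using () renaming (_∈_ to _∈ˡ_)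
open import Data.List.Membership.Propositional.Properties using (∈-allFin)
open import Data.List.Relation.Unary.Any using (here; there)
open import Data.Nat using (ℕ; zero; suc; _+_; _≤_; _<_; _∸_; z≤n; s≤s)
open import Data.Nat.Properties
  using (≤-refl; ≤-reflexive; ≤-trans; <⇒≤; ≤-pred; m≤n⇒m≤1+n; n≤1+n; +-suc; +-mono-≤; +-monoʳ-≤; +-cancelˡ-≤;
         ∸-monoˡ-≤; m≤n+m∸n; m≤n+o⇒m∸n≤o; +-commutativeSemigroup; module ≤-Reasoning)
open import Algebra.Properties.CommutativeSemigroup +-commutativeSemigroup using (interchange)
open import Data.Product using (Σ; ∃; _×_; _,_; proj₁)
open import Data.Sum using (_⊎_; inj₁; inj₂; [_,_]; [_,_]′)
import Data.Sum as Sum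
open import Data.Sum.Function.Propositional using (_⊎-cong_)
import Data.Unit as Unit
open import Data.Vec using (Vec; []; _∷_; here; there)
open import Data.Vec.Properties.WithK using ([]=-irrelevant)
open import Function using (_∘_)
open import Function.Bundles using (_↔_; mk↔ₛ′; Inverse; Injection)
open import Function.Definitions using (Injective)
open import Function.Properties.Inverse using (↔-sym; ↔-trans; ↔⇒↣)
open import Relation.Nullary using (¬_; ¬?; Dec; yes; no; does; contradiction)
open import Relation.Nullary.Decidable using (map′; _×-dec_; _⊎-dec_)
open import Relation.Nullary.Irrelevant using (Irrelevant)
open import Relation.Unary using (Pred) renaming (Decidable to DecidablePred)
open import Relation.Binary.Definitions using (Decidable)
open import Relation.Binary.PropositionalEquality using (_≡_; refl; sym; trans; cong; subst; module ≡-Reasoning)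

private variable
  A B C : Set
  i j k : ℕ

HasSize-⊎ : HasSize A i → HasSize B j → HasSize (A ⊎ B) (i + j)
HasSize-⊎ hA hB = ↔-trans (hA ⊎-cong hB) (↔-sym +↔⊎)

HasSize-Dec : Irrelevant A → Dec A → ∃ (HasSize A)
HasSize-Dec irr (yes p) = 1 , mk↔ₛ′ (λ _ → zero) (λ _ → p) (λ { zero → refl }) (irr p)
HasSize-Dec irr (no ¬p) = 0 , mk↔ₛ′ (λ p → contradiction p ¬p) (λ ()) (λ ()) (λ p → contradiction p ¬p)

Σ-Fin-suc↔ : (P : Fin (suc k) → Set) → Σ (Fin (suc k)) P ↔ (P zero ⊎ Σ (Fin k) (P ∘ suc))
Σ-Fin-suc↔ P = mk↔ₛ′ to from (λ { (inj₁ _) → refl ; (inj₂ _) → refl }) (λ { (zero , _) → refl ; (suc _ , _) → refl })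
  where
  to : Σ _ P → P zero ⊎ Σ _ (P ∘ suc)
  to (zero , p) = inj₁ p
  to (suc i , p) = inj₂ (i , p)
  from : P zero ⊎ Σ _ (P ∘ suc) → Σ _ P
  from (inj₁ p) = zero , p
  from (inj₂ (i , p)) = suc i , p

HasSize-Σ-Fin : {P : Pred (Fin k) _} → (∀ i → Irrelevant (P i)) → DecidablePred P → ∃ (HasSize (Σ (Fin k) P))
HasSize-Σ-Fin {zero} _ _ = 0 , mk↔ₛ′ (λ { (() , _) }) (λ ()) (λ ()) (λ { (() , _) })
HasSize-Σ-Fin {suc k} {P} irr P? with HasSize-Dec (irr zero) (P? zero) | HasSize-Σ-Fin (irr ∘ suc) (P? ∘ suc)
... | i , hi | j , hj = i + j , ↔-trans (Σ-Fin-suc↔ P) (HasSize-⊎ hi hj)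

Σ-×-⊎↔ : {P Q R : A → Set} → Σ A (λ x → P x × (Q x ⊎ R x)) ↔ (Σ A (λ x → P x × Q x) ⊎ Σ A (λ x → P x × R x))
Σ-×-⊎↔ = mk↔ₛ′ to from (λ { (inj₁ _) → refl ; (inj₂ _) → refl }) (λ { (_ , _ , inj₁ _) → refl ; (_ , _ , inj₂ _) → refl })
  where
  to : Σ _ (λ x → _ × (_ ⊎ _)) → _
  to (x , p , inj₁ q) = inj₁ (x , p , q)
  to (x , p , inj₂ r) = inj₂ (x , p , r)
  from : _ → Σ _ (λ x → _ × (_ ⊎ _))
  from (inj₁ (x , p , q)) = x , p , inj₁ q
  from (inj₂ (x , p , r)) = x , p , inj₂ r

HasSize-≤ : HasSize A i → HasSize B j → (f : A → B) (labelA : A → C) (labelB : B → C)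
          → (∀ x → labelB (f x) ≡ labelA x) → Injective _≡_ _≡_ labelA → i ≤ j
HasSize-≤ hA hB f labelA labelB commutes inj = injective⇒≤ {f = to hB ∘ f ∘ from hA} λ {i} {j} eq →
  injective (↔⇒↣ (↔-sym hA)) (inj (begin
    labelA (from hA i)     ≡⟨ commutes _ ⟨
    labelB (f (from hA i)) ≡⟨ cong labelB (injective (↔⇒↣ hB) eq) ⟩
    labelB (f (from hA j)) ≡⟨ commutes _ ⟩
    labelA (from hA j)     ∎))
  where open Inverse using (to; from)
        open Injection using (injective)
        open ≡-Reasoning

record Restores (S S′ : Subset k) (f : Fin k) : Set where
  field
    shrinks : S′ ⊆ S
    f∈S     : f ∈ S
    f∉S′    : f ∉ S′
    only-f  : ∀ {e} → e ∈ S → e ∉ S′ → e ≡ f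

⊆-by-one : {S S′ : Subset k} {f : Fin k} → (∀ {e} → e ∈ S → e ∉ S′ → e ≡ f) → (f ∈ S → f ∈ S′) → S ⊆ S′
⊆-by-one {S′ = S′} only f∈S⇒f∈S′ {e} e∈S with e ∈? S′
... | yes e∈S′ = e∈S′
... | no e∉S′ with only e∈S e∉S′
...   | refl = f∈S⇒f∈S′ e∈S

Restores-or-≡ : {S S′ : Subset k} {f : Fin k} → S′ ⊆ S → (∀ {e} → e ∈ S → e ∉ S′ → e ≡ f) → Restores S S′ f ⊎ S ≡ S′
Restores-or-≡ {S = S} {S′} {f} S′⊆S only with f ∈? S | f ∈? S′
... | yes f∈S | no f∉S′ = inj₁ (record { shrinks = S′⊆S ; f∈S = f∈S ; f∉S′ = f∉S′ ; only-f = only })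
... | yes _   | yes f∈S′ = inj₂ (⊆-antisym (⊆-by-one only (λ _ → f∈S′)) S′⊆S)
... | no f∉S  | _ = inj₂ (⊆-antisym (⊆-by-one only (λ f∈S → contradiction f∈S f∉S)) S′⊆S)

splice : ℕ → Vec A k → Vec A k → Vec A k
splice zero    xs       ys       = xs
splice (suc i) []       []       = []
splice (suc i) (_ ∷ xs) (y ∷ ys) = y ∷ splice i xs ys

splice-length : (xs ys : Vec A k) → splice k xs ys ≡ ys
splice-length []       []       = refl
splice-length (_ ∷ xs) (y ∷ ys) = cong (y ∷_) (splice-length xs ys)

splice-suc-⊆ : ∀ i {S S′ : Subset k} → S′ ⊆ S → splice (suc i) S S′ ⊆ splice i S S′
splice-suc-⊆ zero    {_ ∷ _} {_ ∷ _} S′⊆S (there p) = there p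
splice-suc-⊆ zero    {_ ∷ _} {_ ∷ _} S′⊆S here      = S′⊆S here
splice-suc-⊆ (suc i) {_ ∷ _} {_ ∷ _} S′⊆S here      = here
splice-suc-⊆ (suc i) {_ ∷ _} {_ ∷ _} S′⊆S (there p) = there (splice-suc-⊆ i (drop-∷-⊆ S′⊆S) p)

splice-suc-only : ∀ i (S S′ : Subset k) {e} → e ∈ splice i S S′ → e ∉ splice (suc i) S S′ → toℕ e ≡ i
splice-suc-only zero    (_ ∷ _) (_ ∷ _) {zero}  _         _   = refl
splice-suc-only zero    (_ ∷ _) (_ ∷ _) {suc e} (there p) ∉sp = contradiction (there p) ∉sp
splice-suc-only (suc i) (_ ∷ _) (_ ∷ _) {zero}  here      ∉sp = contradiction here ∉sp
splice-suc-only (suc i) (_ ∷ S) (_ ∷ S′) {suc e} (there p) ∉sp =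
  cong suc (splice-suc-only i S S′ p (λ q → ∉sp (there q)))

-- Walk from S to S′ through the splices: consecutive ones differ at most in the edge i.
restore-induction : (Q : Subset k → Set) → (∀ {S S′ f} → Restores S S′ f → Q S → Q S′)
                  → ∀ {S S′} → S′ ⊆ S → Q S → Q S′
restore-induction {k} Q step {S} {S′} S′⊆S QS = subst Q (splice-length S S′) (go k ≤-refl)
  where
  go : ∀ i → i ≤ k → Q (splice i S S′)
  go zero    _   = QS
  go (suc i) i<k with Restores-or-≡ (splice-suc-⊆ i S′⊆S) only-i
    where
    only-i : ∀ {e} → e ∈ splice i S S′ → e ∉ splice (suc i) S S′ → e ≡ fromℕ< i<k
    only-i e∈ e∉ = toℕ-injective (trans (splice-suc-only i S S′ e∈ e∉) (sym (toℕ-fromℕ< i<k)))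
  ... | inj₁ restores = step restores (go i (<⇒≤ i<k))
  ... | inj₂ same     = subst Q same (go i (<⇒≤ i<k))

module _ {G : Graph} where

  private variable
    S S′ : Subset (m G)
    x y w : Fin (n G)

  Path-trans : Path G S x y → Path G S y w → Path G S x w
  Path-trans here         q = q
  Path-trans (fwd e ne p) q = fwd e ne (Path-trans p q)
  Path-trans (bwd e ne p) q = bwd e ne (Path-trans p q)

  Path-sym : Path G S x y → Path G S y x
  Path-sym here         = here
  Path-sym (fwd e ne p) = Path-trans (Path-sym p) (bwd e ne here)
  Path-sym (bwd e ne p) = Path-trans (Path-sym p) (fwd e ne here)

  Path-mono : S′ ⊆ S → Path G S x y → Path G S′ x y
  Path-mono S′⊆S here         = here
  Path-mono S′⊆S (fwd e ne p) = fwd e (λ e∈S′ → ne (S′⊆S e∈S′)) (Path-mono S′⊆S p)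
  Path-mono S′⊆S (bwd e ne p) = bwd e (λ e∈S′ → ne (S′⊆S e∈S′)) (Path-mono S′⊆S p)

  Path-⊤ : Path G ⊤ x y → x ≡ y
  Path-⊤ here         = refl
  Path-⊤ (fwd e ne _) = contradiction ∈⊤ ne
  Path-⊤ (bwd e ne _) = contradiction ∈⊤ ne

  Conn-refl : Conn G S x x
  Conn-refl = conn here

  Conn-sym : Conn G S x y → Conn G S y x
  Conn-sym (conn p) = conn (Path-sym p)

  Conn-trans : Conn G S x y → Conn G S y w → Conn G S x w
  Conn-trans (conn p) (conn q) = conn (Path-trans p q)

  Conn-mono : S′ ⊆ S → Conn G S x y → Conn G S′ x y
  Conn-mono S′⊆S (conn p) = conn (Path-mono S′⊆S p)

  Conn-edge : (e : Fin (m G)) → e ∉ S → Conn G S (src G e) (tgt G e)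
  Conn-edge e e∉S = conn (fwd e e∉S here)

  Conn-⊤-dec : Decidable (Conn G ⊤)
  Conn-⊤-dec x y with x ≟ y
  ... | yes refl = yes Conn-refl
  ... | no x≢y   = no λ { (conn p) → ⊥-elim-irr (x≢y (Path-⊤ p)) }

-- x reaches w in R directly, or by crossing the extra edge a — b once (in either direction).
Via : (A → A → Set) → A → A → A → A → Set
Via R a b x w = R x w ⊎ (R x a × R b w) ⊎ (R x b × R a w)

Via-map : {R R′ : A → A → Set} {a b x w : A} → (∀ {y z} → R y z → R′ y z) → Via R a b x w → Via R′ a b x w
Via-map g = Sum.map g (Sum.map (λ (p , q) → g p , g q) (λ (p , q) → g p , g q))

Via-dec : {R : A → A → Set} → Decidable R → ∀ a b → Decidable (Via R a b)
Via-dec R? a b x w = R? x w ⊎-dec (R? x a ×-dec R? b w) ⊎-dec (R? x b ×-dec R? a w)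

module _ {G : Graph} {S S′ : Subset (m G)} {f : Fin (m G)} (restores : Restores S S′ f) where
  open Restores restores

  private
    a = src G f
    b = tgt G f
    variable x y w : Fin (n G)

  Via-cons : Path G S x y → Via (Path G S) a b y w → Via (Path G S) a b x w
  Via-cons p = Sum.map (Path-trans p) (Sum.map (λ (q , r) → Path-trans p q , r) (λ (q , r) → Path-trans p q , r))

  Via-from-tgt : Via (Path G S) a b b w → Via (Path G S) a b a w
  Via-from-tgt (inj₁ q)             = inj₂ (inj₁ (here , q))
  Via-from-tgt (inj₂ (inj₁ (_ , q))) = inj₂ (inj₁ (here , q))
  Via-from-tgt (inj₂ (inj₂ (_ , q))) = inj₁ q

  Via-from-src : Via (Path G S) a b a w → Via (Path G S) a b b w
  Via-from-src (inj₁ q)             = inj₂ (inj₂ (here , q))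
  Via-from-src (inj₂ (inj₁ (_ , q))) = inj₁ q
  Via-from-src (inj₂ (inj₂ (_ , q))) = inj₂ (inj₂ (here , q))

  -- The only edge usable in G ∖ S′ but not in G ∖ S is f.
  Path-restore : Path G S′ x w → Via (Path G S) a b x w
  Path-restore here = inj₁ here
  Path-restore (fwd e e∉S′ p) with e ∈? S
  ... | no e∉S = Via-cons (fwd e e∉S here) (Path-restore p)
  ... | yes e∈S with only-f e∈S e∉S′
  ...   | refl = Via-from-tgt (Path-restore p)
  Path-restore (bwd e e∉S′ p) with e ∈? S
  ... | no e∉S = Via-cons (bwd e e∉S here) (Path-restore p)
  ... | yes e∈S with only-f e∈S e∉S′
  ...   | refl = Via-from-src (Path-restore p)

  Via-to-Conn : Via (Conn G S) a b x w → Conn G S′ x w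
  Via-to-Conn (inj₁ c)             = Conn-mono shrinks c
  Via-to-Conn (inj₂ (inj₁ (c , d))) = Conn-trans (Conn-mono shrinks c) (Conn-trans (Conn-edge f f∉S′) (Conn-mono shrinks d))
  Via-to-Conn (inj₂ (inj₂ (c , d))) = Conn-trans (Conn-mono shrinks c) (Conn-trans (Conn-sym (Conn-edge f f∉S′)) (Conn-mono shrinks d))

  Conn-via : Decidable (Conn G S) → Conn G S′ x w → Via (Conn G S) a b x w
  Conn-via {x} {w} C? (conn p) with Via-dec C? a b x w
  ... | yes via = via
  ... | no ¬via = ⊥-elim-irr (¬via (Via-map {R = Path G S} (λ q → conn q) (Path-restore p)))

  Conn-dec-restore : Decidable (Conn G S) → Decidable (Conn G S′)
  Conn-dec-restore C? x w = map′ Via-to-Conn (Conn-via C?) (Via-dec C? a b x w)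

Conn-dec : (G : Graph) (S : Subset (m G)) → Decidable (Conn G S)
Conn-dec G S = restore-induction (λ S → Decidable (Conn G S)) Conn-dec-restore ⊆⊤ Conn-⊤-dec

module _ {G : Graph} {S S′ : Subset (m G)} {f : Fin (m G)} (restores : Restores S S′ f) where
  open Restores restores

  private
    a = src G f
    b = tgt G f
    variable v x : Fin (n G)
    via : Conn G S′ v x → Via (Conn G S) a b v x
    via = Conn-via restores (Conn-dec G S)

  Conn-restore-away : ¬ Conn G S′ v a → Conn G S′ v x → Conn G S v x
  Conn-restore-away ¬va c with via c
  ... | inj₁ vx              = vx
  ... | inj₂ (inj₁ (va , _)) = contradiction (Conn-mono shrinks va) ¬va
  ... | inj₂ (inj₂ (vb , _)) = contradiction (Conn-trans (Conn-mono shrinks vb) (Conn-sym (Conn-edge f f∉S′))) ¬va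

  Conn-restore-src : Conn G S′ a x → Conn G S a x ⊎ Conn G S b x
  Conn-restore-src c with via c
  ... | inj₁ ax              = inj₁ ax
  ... | inj₂ (inj₁ (_ , bx)) = inj₂ bx
  ... | inj₂ (inj₂ (_ , ax)) = inj₁ ax

Component : (G : Graph) → Subset (m G) → Fin (n G) → Set
Component G S v = Σ (Fin (n G)) (Conn G S v)

EdgeEnds : (G : Graph) → Subset (m G) → Fin (n G) → Set
EdgeEnds G S v = Σ (Fin (m G)) λ e → (e ∈ S) × (Conn G S v (src G e) ⊎ Conn G S v (tgt G e))

-- AssocDistributable T S unfolds to DistributableAt (graph T) S; nothing below needs G to be a tree.
DistributableAt : (G : Graph) → Subset (m G) → Set
DistributableAt G S = ∀ v (c d : ℕ) → HasSize (Component G S v) c → HasSize (EdgeEnds G S v) d → d ∸ 1 ≤ c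

m∸n≤o⇒m≤n+o : ∀ m n {o} → m ∸ n ≤ o → m ≤ n + o
m∸n≤o⇒m≤n+o m n m∸n≤o = ≤-trans (m≤n+m∸n m n) (+-monoʳ-≤ n m∸n≤o)

∸1-mono : ∀ {d′ d c c′} → d′ ≤ d → d ∸ 1 ≤ c → c ≤ c′ → d′ ∸ 1 ≤ c′
∸1-mono d′≤d d∸1≤c c≤c′ = ≤-trans (∸-monoˡ-≤ 1 d′≤d) (≤-trans d∸1≤c c≤c′)

∸1-merge : ∀ {d′ d₁ d₂ c₁ c₂ c′} → suc d′ ≤ d₁ + d₂ → d₁ ∸ 1 ≤ c₁ → d₂ ∸ 1 ≤ c₂ → c₁ + c₂ ≤ c′ → d′ ∸ 1 ≤ c′
∸1-merge {d′} {d₁} {d₂} {c₁} {c₂} {c′} d′<d₁+d₂ h₁ h₂ c₁+c₂≤c′ = m≤n+o⇒m∸n≤o d′ 1 (≤-pred (begin-strict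
  d′                      <⟨ d′<d₁+d₂ ⟩
  d₁ + d₂                 ≤⟨ +-mono-≤ (m∸n≤o⇒m≤n+o d₁ 1 h₁) (m∸n≤o⇒m≤n+o d₂ 1 h₂) ⟩
  suc c₁ + suc c₂         ≡⟨ cong suc (+-suc c₁ c₂) ⟩
  suc (suc (c₁ + c₂))     ≤⟨ s≤s (s≤s c₁+c₂≤c′) ⟩
  suc (suc c′)            ∎))
  where open ≤-Reasoning

module _ {G : Graph} where

  private variable
    S S′ : Subset (m G)
    v w : Fin (n G)
    c c′ d d′ : ℕ

  Component-size : ∀ S v → Σ ℕ (HasSize (Component G S v))
  Component-size S v = HasSize-Σ-Fin (λ _ _ _ → refl) (Conn-dec G S v)

  EdgeEnds-size : ∀ S v → Σ ℕ (HasSize (EdgeEnds G S v))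
  EdgeEnds-size S v with ends-at (src G) | ends-at (tgt G)
    where
    ends-at : (end : Fin (m G) → Fin (n G)) → Σ ℕ (HasSize (Σ (Fin (m G)) λ e → (e ∈ S) × Conn G S v (end e)))
    ends-at end = HasSize-Σ-Fin (λ _ (p , _) (q , _) → cong (_, _) ([]=-irrelevant p q)) (λ e → (e ∈? S) ×-dec Conn-dec G S v (end e))
  ... | d₁ , h₁ | d₂ , h₂ = d₁ + d₂ , ↔-trans Σ-×-⊎↔ (HasSize-⊎ h₁ h₂)

  Component-label-injective : Injective _≡_ _≡_ (proj₁ {B = Conn G S v})
  Component-label-injective refl = refl

  end-label : EdgeEnds G S v → Fin (m G) × Bool
  end-label (e , _ , inj₁ _) = e , true
  end-label (e , _ , inj₂ _) = e , false

  end-label-injective : Injective _≡_ _≡_ (end-label {S} {v})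
  end-label-injective {x = e , p , inj₁ _} {_ , q , inj₁ _} refl = cong (λ r → e , r , _) ([]=-irrelevant p q)
  end-label-injective {x = e , p , inj₂ _} {_ , q , inj₂ _} refl = cong (λ r → e , r , _) ([]=-irrelevant p q)

  Component-≤ : HasSize (Component G S v) c → HasSize (Component G S′ w) c′
              → (∀ {u} → Conn G S v u → Conn G S′ w u) → c ≤ c′
  Component-≤ hc hc′ g = HasSize-≤ hc hc′ (λ (u , vu) → u , g vu) proj₁ proj₁ (λ _ → refl) Component-label-injective

  EdgeEnds-map : S′ ⊆ S → (∀ {u} → Conn G S′ v u → Conn G S w u) → EdgeEnds G S′ v → EdgeEnds G S w
  EdgeEnds-map S′⊆S g (e , e∈S′ , ends) = e , S′⊆S e∈S′ , Sum.map g g ends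

  end-label-map : (S′⊆S : S′ ⊆ S) (g : ∀ {u} → Conn G S′ v u → Conn G S w u) (x : EdgeEnds G S′ v)
                → end-label (EdgeEnds-map S′⊆S g x) ≡ end-label x
  end-label-map _ _ (_ , _ , inj₁ _) = refl
  end-label-map _ _ (_ , _ , inj₂ _) = refl

  EdgeEnds-≤ : HasSize (EdgeEnds G S′ v) d′ → HasSize (EdgeEnds G S w) d
             → S′ ⊆ S → (∀ {u} → Conn G S′ v u → Conn G S w u) → d′ ≤ d
  EdgeEnds-≤ hd′ hd S′⊆S g = HasSize-≤ hd′ hd (EdgeEnds-map S′⊆S g) end-label end-label (end-label-map S′⊆S g) end-label-injective

  Component-⊎-≤ : ∀ {x y c₁ c₂} → ¬ Conn G S x y
                → HasSize (Component G S x) c₁ → HasSize (Component G S y) c₂ → HasSize (Component G S′ w) c′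
                → (∀ {u} → Conn G S x u → Conn G S′ w u) → (∀ {u} → Conn G S y u → Conn G S′ w u) → c₁ + c₂ ≤ c′
  Component-⊎-≤ {S = S} {x = x} {y} ¬xy h₁ h₂ hc′ g₁ g₂ =
    HasSize-≤ (HasSize-⊎ h₁ h₂) hc′ [ (λ (u , xu) → u , g₁ xu) , (λ (u , yu) → u , g₂ yu) ]
      [ proj₁ , proj₁ ] proj₁ (λ { (inj₁ _) → refl ; (inj₂ _) → refl }) label-injective
    where
    label-injective : Injective _≡_ _≡_ [ proj₁ {B = Conn G S x} , proj₁ {B = Conn G S y} ]
    label-injective {inj₁ _}        {inj₁ _}        refl = refl
    label-injective {inj₂ _}        {inj₂ _}        refl = refl
    label-injective {inj₁ (_ , xu)} {inj₂ (_ , yu)} refl = contradiction (Conn-trans xu (Conn-sym yu)) ¬xy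
    label-injective {inj₂ (_ , yu)} {inj₁ (_ , xu)} refl = contradiction (Conn-trans xu (Conn-sym yu)) ¬xy

module _ {G : Graph} {S S′ : Subset (m G)} {f : Fin (m G)} (restores : Restores S S′ f) (DS : DistributableAt G S) where
  open Restores restores

  private
    a = src G f
    b = tgt G f
    variable
      v : Fin (n G)
      c′ d′ : ℕ

  restore-away : ¬ Conn G S′ v a → HasSize (Component G S′ v) c′ → HasSize (EdgeEnds G S′ v) d′ → d′ ∸ 1 ≤ c′
  restore-away {v} ¬va hc′ hd′ with Component-size S v | EdgeEnds-size S v
  ... | c , hc | d , hd = ∸1-mono (EdgeEnds-≤ hd′ hd shrinks (Conn-restore-away restores ¬va))
                                  (DS v c d hc hd)
                                  (Component-≤ hc hc′ (Conn-mono shrinks))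

  restore-joined : Conn G S′ v a → Conn G S a b → HasSize (Component G S′ v) c′ → HasSize (EdgeEnds G S′ v) d′ → d′ ∸ 1 ≤ c′
  restore-joined {v} va ab hc′ hd′ with Component-size S a | EdgeEnds-size S a
  ... | c , hc | d , hd = ∸1-mono (EdgeEnds-≤ hd′ hd shrinks at-a)
                                  (DS a c d hc hd)
                                  (Component-≤ hc hc′ (λ au → Conn-trans va (Conn-mono shrinks au)))
    where
    at-a : ∀ {u} → Conn G S′ v u → Conn G S a u
    at-a vu = [ (λ au → au) , Conn-trans ab ]′ (Conn-restore-src restores (Conn-trans (Conn-sym va) vu))

  module _ {v : Fin (n G)} (va : Conn G S′ v a) where

    end-side : ∀ {u} → Conn G S′ v u → Conn G S a u ⊎ Conn G S b u
    end-side vu = Conn-restore-src restores (Conn-trans (Conn-sym va) vu)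

    -- The extra element stands for the src end of f, which lies in the component of a.
    ends-split : Unit.⊤ ⊎ EdgeEnds G S′ v → EdgeEnds G S a ⊎ EdgeEnds G S b
    ends-split (inj₁ Unit.tt) = inj₁ (f , f∈S , inj₁ Conn-refl)
    ends-split (inj₂ (e , e∈S′ , inj₁ vu)) with end-side vu
    ... | inj₁ au = inj₁ (e , shrinks e∈S′ , inj₁ au)
    ... | inj₂ bu = inj₂ (e , shrinks e∈S′ , inj₁ bu)
    ends-split (inj₂ (e , e∈S′ , inj₂ vu)) with end-side vu
    ... | inj₁ au = inj₁ (e , shrinks e∈S′ , inj₂ au)
    ... | inj₂ bu = inj₂ (e , shrinks e∈S′ , inj₂ bu)

    extended-label : Unit.⊤ ⊎ EdgeEnds G S′ v → Fin (m G) × Bool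
    extended-label = [ (λ _ → f , true) , end-label ]

    ends-split-label : ∀ x → [ end-label , end-label ] (ends-split x) ≡ extended-label x
    ends-split-label (inj₁ Unit.tt) = refl
    ends-split-label (inj₂ (e , e∈S′ , inj₁ vu)) with end-side vu
    ... | inj₁ _ = refl
    ... | inj₂ _ = refl
    ends-split-label (inj₂ (e , e∈S′ , inj₂ vu)) with end-side vu
    ... | inj₁ _ = refl
    ... | inj₂ _ = refl

    extended-label-injective : Injective _≡_ _≡_ extended-label
    extended-label-injective {inj₁ Unit.tt}             {inj₁ Unit.tt}             _    = refl
    extended-label-injective {inj₂ _}                   {inj₂ _}                   eq   = cong inj₂ (end-label-injective eq)
    extended-label-injective {inj₁ Unit.tt}             {inj₂ (_ , e∈S′ , inj₁ _)} refl = contradiction e∈S′ f∉S′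
    extended-label-injective {inj₂ (_ , e∈S′ , inj₁ _)} {inj₁ Unit.tt}             refl = contradiction e∈S′ f∉S′

    restore-split : ¬ Conn G S a b → HasSize (Component G S′ v) c′ → HasSize (EdgeEnds G S′ v) d′ → d′ ∸ 1 ≤ c′
    restore-split ¬ab hc′ hd′ with Component-size S a | EdgeEnds-size S a | Component-size S b | EdgeEnds-size S b
    ... | c₁ , hc₁ | d₁ , hd₁ | c₂ , hc₂ | d₂ , hd₂ =
      ∸1-merge {d₁ = d₁} {d₂}
        (HasSize-≤ (HasSize-⊎ (↔-sym 1↔⊤) hd′) (HasSize-⊎ hd₁ hd₂) ends-split
                   extended-label [ end-label , end-label ] ends-split-label extended-label-injective)
        (DS a c₁ d₁ hc₁ hd₁) (DS b c₂ d₂ hc₂ hd₂)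
        (Component-⊎-≤ ¬ab hc₁ hc₂ hc′ (λ au → Conn-trans va (Conn-mono shrinks au))
                                     (λ bu → Conn-trans va (Conn-trans (Conn-edge f f∉S′) (Conn-mono shrinks bu))))

  DistributableAt-restore : DistributableAt G S′
  DistributableAt-restore v c′ d′ hc′ hd′ with Conn-dec G S′ v a | Conn-dec G S a b
  ... | no ¬va | _      = restore-away ¬va hc′ hd′
  ... | yes va | yes ab = restore-joined va ab hc′ hd′
  ... | yes va | no ¬ab = restore-split va ¬ab hc′ hd′

module _ {A : Set} {ℓ} {P Q : Pred A ℓ} (P? : DecidablePred P) (Q? : DecidablePred Q) where

  length-filter-⊎ : ∀ xs → length (filter (λ x → P? x ⊎-dec Q? x) xs)
                         ≤ length (filter P? xs) + length (filter Q? xs)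
  length-filter-⊎ [] = z≤n
  length-filter-⊎ (x ∷ xs) with does (P? x) | does (Q? x)
  ... | false | false = length-filter-⊎ xs
  ... | true  | false = s≤s (length-filter-⊎ xs)
  ... | false | true  = ≤-trans (s≤s (length-filter-⊎ xs)) (≤-reflexive (sym (+-suc (length (filter P? xs)) (length (filter Q? xs)))))
  ... | true  | true  = s≤s (≤-trans (length-filter-⊎ xs) (+-monoʳ-≤ (length (filter P? xs)) (n≤1+n _)))

module _ {A : Set} {ℓ₁ ℓ₂} {R : Pred A ℓ₁} {P : Pred A ℓ₂} (R? : DecidablePred R) (P? : DecidablePred P) where

  length-filter-× : ∀ xs → length (filter (λ x → R? x ×-dec P? x) xs) ≤ length (filter P? xs)
  length-filter-× [] = z≤n
  length-filter-× (x ∷ xs) with does (R? x) | does (P? x)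
  ... | false | false = length-filter-× xs
  ... | true  | false = length-filter-× xs
  ... | false | true  = m≤n⇒m≤1+n (length-filter-× xs)
  ... | true  | true  = s≤s (length-filter-× xs)

  length-filter-×-< : ∀ {x xs} → x ∈ˡ xs → ¬ R x → P x → length (filter (λ x → R? x ×-dec P? x) xs) < length (filter P? xs)
  length-filter-×-< {x} {_ ∷ xs} (here refl) ¬Rx Px with R? x | P? x
  ... | yes Rx | _ = contradiction Rx ¬Rx
  ... | no _ | no ¬Px = contradiction Px ¬Px
  ... | no _ | yes _ = s≤s (length-filter-× xs)
  length-filter-×-< {xs = y ∷ ys} (there x∈ys) ¬Rx Px with does (R? y) | does (P? y)
  ... | false | false = length-filter-×-< x∈ys ¬Rx Px
  ... | true  | false = length-filter-×-< x∈ys ¬Rx Px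
  ... | false | true  = m≤n⇒m≤1+n (length-filter-×-< x∈ys ¬Rx Px)
  ... | true  | true  = s≤s (length-filter-×-< x∈ys ¬Rx Px)

contractedDeg-+2 : ∀ G e → 2 + contractedDeg G e ≤ deg G (src G e) + deg G (tgt G e)
contractedDeg-+2 G e = begin
  2 + contractedDeg G e                                             ≡⟨ cong suc (+-suc (ends (src G)) (ends (tgt G))) ⟨
  suc (ends (src G)) + suc (ends (tgt G))                           ≤⟨ +-mono-≤ (at-a-or-b (src G) (inj₁ refl)) (at-a-or-b (tgt G) (inj₂ refl)) ⟩
  (#at (src G) a + #at (src G) b) + (#at (tgt G) a + #at (tgt G) b) ≡⟨ interchange (#at (src G) a) _ _ _ ⟩
  deg G a + deg G b                                                 ∎
  where
  open ≤-Reasoning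
  a = src G e
  b = tgt G e
  #at : (Fin (m G) → Fin (n G)) → Fin (n G) → ℕ
  #at end v = length (filter (λ e′ → end e′ ≟ v) (allFin (m G)))
  ends : (Fin (m G) → Fin (n G)) → ℕ
  ends end = length (filter (λ e′ → ¬? (e′ ≟ e) ×-dec (end e′ ≟ a ⊎-dec end e′ ≟ b)) (allFin (m G)))
  at-a-or-b : ∀ end → end e ≡ a ⊎ end e ≡ b → suc (ends end) ≤ #at end a + #at end b
  at-a-or-b end e-at = ≤-trans
    (length-filter-×-< (λ e′ → ¬? (e′ ≟ e)) (λ e′ → end e′ ≟ a ⊎-dec end e′ ≟ b) (∈-allFin e) (λ e≢e → e≢e refl) e-at)
    (length-filter-⊎ (λ e′ → end e′ ≟ a) (λ e′ → end e′ ≟ b) (allFin (m G)))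

contractedDeg-≤ : (T : Tree) (cap : Fin (n (graph T)) → ℕ) → Distributable T cap
                → (e : Fin (m (graph T))) → contractedDeg (graph T) e ≤ cap (src (graph T) e) + cap (tgt (graph T) e)
contractedDeg-≤ T cap distributable e = +-cancelˡ-≤ 2 _ _ (begin
  2 + contractedDeg G e                     ≤⟨ contractedDeg-+2 G e ⟩
  deg G (src G e) + deg G (tgt G e)         ≤⟨ +-mono-≤ (deg≤1+cap (src G e)) (deg≤1+cap (tgt G e)) ⟩
  suc (cap (src G e)) + suc (cap (tgt G e)) ≡⟨ cong suc (+-suc (cap (src G e)) (cap (tgt G e))) ⟩
  2 + (cap (src G e) + cap (tgt G e))       ∎)
  where
  open ≤-Reasoning
  G = graph T
  deg≤1+cap : ∀ v → deg G v ≤ suc (cap v)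
  deg≤1+cap v = m∸n≤o⇒m≤n+o (deg G v) 1 (distributable v)

lemma2p4 : ((T : Tree) (σ τ : Face T) → σ ≼ τ → FaceDistributable τ → FaceDistributable σ)
           × ((T : Tree) (cap : Fin (n (graph T)) → ℕ) → Distributable T cap
              → (e : Fin (m (graph T)))
              → contractedDeg (graph T) e ≤ cap (src (graph T) e) + cap (tgt (graph T) e))
lemma2p4 = (λ T σ τ (deleted⊆ , _) →
              restore-induction (DistributableAt (graph T)) DistributableAt-restore deleted⊆)
         , contractedDeg-≤
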